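{- Let $p$ be a prime, let $w_1,w_2,w_3$ be positive integers, let $y_1,y_2\in\mathbb{Z}_p$, and let $n\ge 0$ be an integer. Then the following six expressions are all equal: \begin{align*} &\sum_{k+\ell+m=n}\binom{n}{k,\ell,m}B_{k}(w_{1}y_{1})B_{\ell}(w_{2}y_{2})S_{m}(w_{3}-1)\,w_{1}^{\ell+m}w_{2}^{k+m}w_{3}^{k+\ell-1}\\ &=\sum_{k+\ell+m=n}\binom{n}{k,\ell,m}B_{k}(w_{1}y_{1})B_{\ell}(w_{3}y_{2})S_{m}(w_{2}-1)\,w_{1}^{\ell+m}w_{3}^{k+m}w_{2}^{k+\ell-1}\\ &=\sum_{k+\ell+m=n}\binom{n}{k,\ell,m}B_{k}(w_{2}y_{1})B_{\ell}(w_{1}y_{2})S_{m}(w_{3}-1)\,w_{2}^{\ell+m}w_{1}^{k+m}w_{3}^{k+\ell-1}\\ &=\sum_{k+\ell+m=n}\binom{n}{k,\ell,m}B_{k}(w_{2}y_{1})B_{\ell}(w_{3}y_{2})S_{m}(w_{1}-1)\,w_{2}^{\ell+m}w_{3}^{k+m}w_{1}^{k+\ell-1}\\ &=\sum_{k+\ell+m=n}\binom{n}{k,\ell,m}B_{k}(w_{3}y_{1})B_{\ell}(w_{2}y_{2})S_{m}(w_{1}-1)\,w_{3}^{\ell+m}w_{2}^{k+m}w_{1}^{k+\ell-1}\\ &=\sum_{k+\ell+m=n}\binom{n}{k,\ell,m}B_{k}(w_{3}y_{1})B_{\ell}(w_{1}y_{2})S_{m}(w_{2}-1)\,w_{3}^{\ell+m}w_{1}^{k+m}w_{2}^{k+\ell-1}.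 \end{align*}
   Context: $\mathbb{Z}_p$ denotes the ring of $p$-adic integers. The Bernoulli polynomials $B_n(x)$ are defined by $\frac{t}{e^t-1}e^{xt}=\sum_{n\ge0}B_n(x)\frac{t^n}{n!}$. For integers $k,N\ge0$, $S_k(N)=\sum_{i=0}^{N}i^k=0^k+1^k+\cdots+N^k$, with the convention $0^0=1$ (so $S_0(N)=N+1$ and $S_k(0)=0$ for $k>0$). Sums $\sum_{k+\ell+m=n}$ run over all nonnegative integers $k,\ell,m$ with $k+\ell+m=n$, and $\binom{n}{k,\ell,m}=\frac{n!}{k!\,\ell!\,m!}$. -}

module Defs where

open import Level using (Level)
open import Algebra.Bundles using (CommutativeRing)
open import Algebra.Morphism.Structures using (module RingMorphisms)
open import Data.Nat as ℕ using (ℕ; zero; suc; _∸_; NonZero)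
open import Data.Nat.Combinatorics using (_C_)
open import Data.Integer using (+_)
open import Data.Rational as ℚ using (ℚ; _/_)
open import Data.Rational.Properties using (+-*-commutativeRing)
open import Data.Vec using (Vec; []; _∷ʳ_; lookup)
open import Data.Fin using (Fin; toℕ; fromℕ)

IsQAlgebraMap : ∀ {c ℓ} (R : CommutativeRing c ℓ) → (ℚ → CommutativeRing.Carrier R) → Set _
IsQAlgebraMap R ι =
  RingMorphisms.IsRingHomomorphism
    (CommutativeRing.rawRing +-*-commutativeRing) (CommutativeRing.rawRing R) ι

-- S_k(N) = 0^k + 1^k + ... + N^k  (with 0^0 = 1, as ℕ._^_ does)
S : ℕ → ℕ → ℕ
S k zero    = 0 ℕ.^ k
S k (suc N) = S k N ℕ.+ (suc N) ℕ.^ k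

-- multinomial coefficient n!/(k! ℓ! m!) for k+ℓ+m = n, written as C(n,k)·C(n-k,ℓ)
multinom : ℕ → ℕ → ℕ → ℕ
multinom n k l = (n C k) ℕ.* ((n ∸ k) C l)

module QAlg {c ℓ} (R : CommutativeRing c ℓ) (ι : ℚ → CommutativeRing.Carrier R) where
  open CommutativeRing R

  _^_ : Carrier → ℕ → Carrier
  x ^ zero  = 1#
  x ^ suc n = x * (x ^ n)

  Σ< : ℕ → (ℕ → Carrier) → Carrier
  Σ< zero    f = 0#
  Σ< (suc n) f = Σ< n f + f n

  -- Bernoulli polynomials from the generating function t/(e^t-1) e^{xt} = Σ B_n(x) t^n/n!:
  -- comparing coefficients of t^n in (e^t-1)/t · Σ B_j(x) t^j/j! = e^{xt} gives
  --   Σ_{j≤n} C(n+1,j)/(n+1) · B_j(x) = x^n,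
  -- i.e. B_n(x) = x^n - Σ_{j<n} C(n+1,j)/(n+1) · B_j(x).
  -- bernVec n x = (B_0(x), …, B_{n-1}(x))
  bernVec : (n : ℕ) → Carrier → Vec Carrier n
  bernVec zero    x = []
  bernVec (suc n) x =
    bernVec n x ∷ʳ (x ^ n - Σ' n (λ j → ι ((+ (suc n C toℕ j)) / suc n) * lookup (bernVec n x) j))
    where
    Σ' : (m : ℕ) → (Fin m → Carrier) → Carrier
    Σ' zero    f = 0#
    Σ' (suc m) f = Σ' m (λ j → f (Data.Fin.inject₁ j)) + f (fromℕ m)

  B : ℕ → Carrier → Carrier
  B n x = lookup (bernVec (suc n) x) (fromℕ n)

  ⟨_⟩ : ℕ → Carrier
  ⟨ w ⟩ = ι ((+ w) / 1)

  -- Σ_{k+ℓ+m=n} (n; k,ℓ,m) B_k(a y₁) B_ℓ(b y₂) S_m(c-1) a^{ℓ+m} b^{k+m} c^{k+ℓ-1}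
  -- (c^{k+ℓ-1} is the rational number c^{k+ℓ}/c, since k+ℓ-1 may be -1)
  E : (a b c : ℕ) → .{{NonZero c}} → Carrier → Carrier → ℕ → Carrier
  E a b c y₁ y₂ n =
    Σ< (suc n) λ k → Σ< (suc (n ∸ k)) λ l →
      let m = n ∸ k ∸ l in
      ι ((+ (multinom n k l ℕ.* S m (c ∸ 1) ℕ.* a ℕ.^ (l ℕ.+ m) ℕ.* b ℕ.^ (k ℕ.+ m)
                ℕ.* c ℕ.^ (k ℕ.+ l))) / c)
        * (B k (⟨ a ⟩ * y₁) * B l (⟨ b ⟩ * y₂))

{-# OPTIONS --safe #-}
-- Let E(t) = Σₙ Eₙ tⁿ/n! for E = E(a,b,c). The multinomial sum makes E(t) the product of three
-- exponential generating functions: those of Bₖ(a y₁) at bct, of Bₗ(b y₂) at act and of Sₘ(c−1)/c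
-- at abt. Since Σ Bₖ(x) tᵏ/k! = t e^{xt}/(eᵗ−1) and Σ Sₘ(c−1) tᵐ/m! = (e^{ct}−1)/(eᵗ−1), multiplying
-- E(t) by K(t) = (e^{bct}−1)/(bct) · (e^{act}−1)/(act) · (e^{abt}−1)/(abt) gives
-- e^{abc y₁ t} e^{abc y₂ t} (e^{abct}−1)/(abct), which is symmetric in a, b, c. So is K, and its
-- constant term is 1, so it cancels: E is invariant under permutations of (a, b, c).
module Submission where

open import Defs
open import Algebra.Bundles using (CommutativeRing)
open import Data.Nat using (ℕ; NonZero)
open import Data.Nat.Primality using (Prime)
open import Data.Rational using (ℚ)
open import Data.Product using (_×_)

open import Algebra.Bundles using (CommutativeSemigroup)
open import Algebra.Morphism.Structures using (module RingMorphisms)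
import Algebra.Properties.CommutativeSemigroup as CommutativeSemigroupProperties
import Algebra.Properties.CommutativeSemiring.Binomial as BinomialTheorem
import Algebra.Properties.CommutativeSemiring.Exp as ExpProperties
import Algebra.Properties.Monoid.Sum as SumProperties
import Algebra.Properties.Ring as RingProperties
import Algebra.Properties.Semiring.Mult as MultProperties
import Algebra.Solver.Ring.NaturalCoefficients.Default as CommutativeSemiringSolver
open import Data.Fin as Fin using (Fin; toℕ; fromℕ; inject₁)
open import Data.Fin.Properties using (toℕ-fromℕ; toℕ-inject₁)
open import Data.Fin.Relation.Unary.Top using (view; ‵fromℕ; ‵inject₁)
open import Data.Integer as ℤ using (+_)
import Data.Integer.Solver as ℤ-Solver
open import Data.Nat as ℕ using (zero; suc; _∸_; _!; _≤_; _<_)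
import Data.Nat.Properties as ℕ
import Data.Nat.Solver as ℕ-Solver
open import Data.Nat.Combinatorics using (_C_; nCk≡n!/k![n-k]!; k![n∸k]!∣n!; nCn≡1; nC1≡n; nCk≡nC[n∸k])
open import Data.Nat.DivMod using (m/n*n≡m)
open import Data.Product using (_,_)
open import Data.Rational as ℚ using (_/_; 1ℚ; toℚᵘ)
open import Data.Rational.Properties using (toℚᵘ-injective; toℚᵘ-fromℚᵘ; toℚᵘ-homo-+; toℚᵘ-homo-*)
open import Data.Rational.Unnormalised as ℚᵘ using (mkℚᵘ; *≡*)
import Data.Rational.Unnormalised.Properties as ℚᵘ
open import Data.Sum using (inj₁; inj₂)
open import Data.Vec using (Vec; []; _∷_; _∷ʳ_; lookup)
open import Function using (_∘_)
open import Relation.Binary.Structures using (IsEquivalence)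
open import Relation.Binary.PropositionalEquality as ≡ using (_≡_)
import Relation.Binary.Reasoning.Setoid as SetoidReasoning

lookup-∷ʳ-fromℕ : ∀ {a} {A : Set a} {n} (xs : Vec A n) y → lookup (xs ∷ʳ y) (fromℕ n) ≡ y
lookup-∷ʳ-fromℕ []       y = ≡.refl
lookup-∷ʳ-fromℕ (x ∷ xs) y = lookup-∷ʳ-fromℕ xs y

lookup-∷ʳ-inject₁ : ∀ {a} {A : Set a} {n} (xs : Vec A n) y i → lookup (xs ∷ʳ y) (inject₁ i) ≡ lookup xs i
lookup-∷ʳ-inject₁ (x ∷ xs) y Fin.zero    = ≡.refl
lookup-∷ʳ-inject₁ (x ∷ xs) y (Fin.suc i) = lookup-∷ʳ-inject₁ xs y i

nCk*[k!*[n∸k]!]≡n! : ∀ {n k} → k ≤ n → (n C k) ℕ.* (k ! ℕ.* (n ∸ k) !) ≡ n !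
nCk*[k!*[n∸k]!]≡n! {n} {k} k≤n =
  ≡.trans (≡.cong (ℕ._* (k ! ℕ.* (n ∸ k) !)) (nCk≡n!/k![n-k]! k≤n))
          (m/n*n≡m {{k ℕ.!* (n ∸ k) !≢0}} (k![n∸k]!∣n! k≤n))

multinom*[k!*[l!*m!]]≡n! : ∀ {n k l} → k ≤ n → l ≤ n ∸ k →
                           multinom n k l ℕ.* (k ! ℕ.* (l ! ℕ.* (n ∸ k ∸ l) !)) ≡ n !
multinom*[k!*[l!*m!]]≡n! {n} {k} {l} k≤n l≤n∸k = begin
  (n C k) ℕ.* ((n ∸ k) C l) ℕ.* (k ! ℕ.* (l ! ℕ.* (n ∸ k ∸ l) !))
    ≡⟨ solve 5 (λ a b x y z → a :* b :* (x :* (y :* z)) := a :* (x :* (b :* (y :* z))))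
             ≡.refl (n C k) ((n ∸ k) C l) (k !) (l !) ((n ∸ k ∸ l) !) ⟩
  (n C k) ℕ.* (k ! ℕ.* (((n ∸ k) C l) ℕ.* (l ! ℕ.* (n ∸ k ∸ l) !)))
    ≡⟨ ≡.cong (λ t → (n C k) ℕ.* (k ! ℕ.* t)) (nCk*[k!*[n∸k]!]≡n! l≤n∸k) ⟩
  (n C k) ℕ.* (k ! ℕ.* (n ∸ k) !)
    ≡⟨ nCk*[k!*[n∸k]!]≡n! k≤n ⟩
  n ! ∎
  where
  open ≡.≡-Reasoning
  open ℕ-Solver.+-*-Solver

toℚᵘ-/ : ∀ i n → toℚᵘ (i / suc n) ℚᵘ.≃ mkℚᵘ i n
toℚᵘ-/ i n = toℚᵘ-fromℚᵘ (mkℚᵘ i n)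

[1+n]/1≡1+n/1 : ∀ n → + suc n / 1 ≡ 1ℚ ℚ.+ + n / 1
[1+n]/1≡1+n/1 n = toℚᵘ-injective (begin
  toℚᵘ (+ suc n / 1)            ≈⟨ toℚᵘ-/ (+ suc n) 0 ⟩
  mkℚᵘ (+ suc n) 0              ≈⟨ *≡* (solve 1 (λ x → (con (+ 1) :+ x) :* con (+ 1)
                                                    := (con (+ 1) :* con (+ 1) :+ x :* con (+ 1)) :* con (+ 1))
                                                ≡.refl (+ n)) ⟩
  ℚᵘ.1ℚᵘ ℚᵘ.+ mkℚᵘ (+ n) 0      ≈⟨ ℚᵘ.+-congʳ ℚᵘ.1ℚᵘ (toℚᵘ-/ (+ n) 0) ⟨
  toℚᵘ 1ℚ ℚᵘ.+ toℚᵘ (+ n / 1)   ≈⟨ toℚᵘ-homo-+ 1ℚ (+ n / 1) ⟨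
  toℚᵘ (1ℚ ℚ.+ + n / 1)         ∎)
  where
  open ℚᵘ.≃-Reasoning
  open ℤ-Solver.+-*-Solver

q/1*p/q≡p/1 : ∀ p q .{{_ : NonZero q}} → (+ q / 1) ℚ.* (+ p / q) ≡ + p / 1
q/1*p/q≡p/1 p (suc q) = toℚᵘ-injective (begin
  toℚᵘ ((+ suc q / 1) ℚ.* (+ p / suc q))      ≈⟨ toℚᵘ-homo-* (+ suc q / 1) (+ p / suc q) ⟩
  toℚᵘ (+ suc q / 1) ℚᵘ.* toℚᵘ (+ p / suc q)  ≈⟨ ℚᵘ.*-cong (toℚᵘ-/ (+ suc q) 0) (toℚᵘ-/ (+ p) q) ⟩
  mkℚᵘ (+ suc q) 0 ℚᵘ.* mkℚᵘ (+ p) q          ≈⟨ *≡* cross-multiplied ⟩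
  mkℚᵘ (+ p) 0                                ≈⟨ toℚᵘ-/ (+ p) 0 ⟨
  toℚᵘ (+ p / 1)                              ∎)
  where
  open ℚᵘ.≃-Reasoning
  cross-multiplied : (+ suc q ℤ.* + p) ℤ.* + 1 ≡ + p ℤ.* + suc (q ℕ.+ 0)
  cross-multiplied rewrite ℕ.+-identityʳ q =
    solve 2 (λ x y → (x :* y) :* con (+ 1) := y :* x) ≡.refl (+ suc q) (+ p)
    where open ℤ-Solver.+-*-Solver

module _ {c ℓ} (R : CommutativeRing c ℓ) (ι : ℚ → CommutativeRing.Carrier R) where

  open CommutativeRing R hiding (zero)
  open QAlg R ι
  open SetoidReasoning setoid
  open CommutativeSemiringSolver commutativeSemiring using (solve; _:=_; _:+_; _:*_)
  open RingProperties ring using (+-cancelˡ; xyx⁻¹≈y)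
  open SumProperties +-monoid using (sum-syntax; sum-cong-≋; sum-init-last)
  open MultProperties semiring using (×1-homo-*; ×-homo-+; ×-assoc-*; ×-congʳ)
    renaming (_×_ to _·_)
  open ExpProperties commutativeSemiring using (^-congˡ; ^-homo-*; ^-distrib-*)
    renaming (_^_ to _^ˢ_)
  open CommutativeSemigroupProperties *-commutativeSemigroup using (x∙yz≈y∙xz; xy∙z≈yx∙z; xy∙z≈xz∙y)

  ^≡^ˢ : ∀ x n → x ^ n ≡ x ^ˢ n
  ^≡^ˢ x zero    = ≡.refl
  ^≡^ˢ x (suc n) = ≡.cong (x *_) (^≡^ˢ x n)

  ^-cong : ∀ n {x y} → x ≈ y → x ^ n ≈ y ^ n
  ^-cong n {x} {y} x≈y = begin
    x ^ n   ≡⟨ ^≡^ˢ x n ⟩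
    x ^ˢ n  ≈⟨ ^-congˡ n x≈y ⟩
    y ^ˢ n  ≡⟨ ^≡^ˢ y n ⟨
    y ^ n   ∎

  ^-+ : ∀ x m n → x ^ (m ℕ.+ n) ≈ x ^ m * x ^ n
  ^-+ x m n = begin
    x ^ (m ℕ.+ n)    ≡⟨ ^≡^ˢ x (m ℕ.+ n) ⟩
    x ^ˢ (m ℕ.+ n)   ≈⟨ ^-homo-* x m n ⟩
    x ^ˢ m * x ^ˢ n  ≡⟨ ≡.cong₂ _*_ (^≡^ˢ x m) (^≡^ˢ x n) ⟨
    x ^ m * x ^ n    ∎

  ^-distribʳ-* : ∀ x y n → (x * y) ^ n ≈ x ^ n * y ^ n
  ^-distribʳ-* x y n = begin
    (x * y) ^ n      ≡⟨ ^≡^ˢ (x * y) n ⟩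
    (x * y) ^ˢ n     ≈⟨ ^-distrib-* x y n ⟩
    x ^ˢ n * y ^ˢ n  ≡⟨ ≡.cong₂ _*_ (^≡^ˢ x n) (^≡^ˢ y n) ⟨
    x ^ n * y ^ n    ∎

  ^-split : ∀ x {k n} → k ≤ n → x ^ k * x ^ (n ∸ k) ≈ x ^ n
  ^-split x {k} {n} k≤n = trans (sym (^-+ x k (n ∸ k))) (reflexive (≡.cong (x ^_) (ℕ.m+[n∸m]≡n k≤n)))

  x^[l+m]y^[k+m]z^[k+l]≈[yz]^k[xz]^l[xy]^m : ∀ x y z k l m →
    x ^ (l ℕ.+ m) * y ^ (k ℕ.+ m) * z ^ (k ℕ.+ l) ≈ (y * z) ^ k * ((x * z) ^ l * (x * y) ^ m)
  x^[l+m]y^[k+m]z^[k+l]≈[yz]^k[xz]^l[xy]^m x y z k l m = begin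
    x ^ (l ℕ.+ m) * y ^ (k ℕ.+ m) * z ^ (k ℕ.+ l)
      ≈⟨ *-cong (*-cong (^-+ x l m) (^-+ y k m)) (^-+ z k l) ⟩
    x ^ l * x ^ m * (y ^ k * y ^ m) * (z ^ k * z ^ l)
      ≈⟨ solve 6 (λ xˡ xᵐ yᵏ yᵐ zᵏ zˡ → xˡ :* xᵐ :* (yᵏ :* yᵐ) :* (zᵏ :* zˡ) := yᵏ :* zᵏ :* (xˡ :* zˡ :* (xᵐ :* yᵐ)))
               refl (x ^ l) (x ^ m) (y ^ k) (y ^ m) (z ^ k) (z ^ l) ⟩
    y ^ k * z ^ k * (x ^ l * z ^ l * (x ^ m * y ^ m))
      ≈⟨ *-cong (^-distribʳ-* y z k) (*-cong (^-distribʳ-* x z l) (^-distribʳ-* x y m)) ⟨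
    (y * z) ^ k * ((x * z) ^ l * (x * y) ^ m) ∎

  Σ<-cong : ∀ n {f g : ℕ → Carrier} → (∀ i → i < n → f i ≈ g i) → Σ< n f ≈ Σ< n g
  Σ<-cong zero    f≈g = refl
  Σ<-cong (suc n) f≈g = +-cong (Σ<-cong n (λ i i<n → f≈g i (ℕ.m<n⇒m<1+n i<n))) (f≈g n (ℕ.n<1+n n))

  Σ<-distrib-+ : ∀ n (f g : ℕ → Carrier) → Σ< n (λ i → f i + g i) ≈ Σ< n f + Σ< n g
  Σ<-distrib-+ zero    f g = sym (+-identityˡ 0#)
  Σ<-distrib-+ (suc n) f g = begin
    Σ< n (λ i → f i + g i) + (f n + g n)  ≈⟨ +-congʳ (Σ<-distrib-+ n f g) ⟩
    Σ< n f + Σ< n g + (f n + g n)         ≈⟨ solve 4 (λ a b x y → a :+ b :+ (x :+ y) := a :+ x :+ (b :+ y))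
                                                   refl (Σ< n f) (Σ< n g) (f n) (g n) ⟩
    Σ< n f + f n + (Σ< n g + g n)         ∎

  *-distribˡ-Σ< : ∀ n x (f : ℕ → Carrier) → x * Σ< n f ≈ Σ< n (λ i → x * f i)
  *-distribˡ-Σ< zero    x f = zeroʳ x
  *-distribˡ-Σ< (suc n) x f = trans (distribˡ x (Σ< n f) (f n)) (+-congʳ (*-distribˡ-Σ< n x f))

  *-distribʳ-Σ< : ∀ n x (f : ℕ → Carrier) → Σ< n f * x ≈ Σ< n (λ i → f i * x)
  *-distribʳ-Σ< n x f =
    trans (*-comm _ x) (trans (*-distribˡ-Σ< n x f) (Σ<-cong n (λ i _ → *-comm x (f i))))

  Σ<-suc : ∀ n (f : ℕ → Carrier) → Σ< (suc n) f ≈ f 0 + Σ< n (f ∘ suc)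
  Σ<-suc zero    f = trans (+-identityˡ (f 0)) (sym (+-identityʳ (f 0)))
  Σ<-suc (suc n) f = trans (+-congʳ (Σ<-suc n f)) (+-assoc (f 0) _ _)

  Σ<-reverse : ∀ n (f : ℕ → Carrier) → Σ< n f ≈ Σ< n (λ i → f (n ∸ suc i))
  Σ<-reverse zero    f = refl
  Σ<-reverse (suc n) f = begin
    Σ< n f + f n                          ≈⟨ +-comm _ _ ⟩
    f n + Σ< n f                          ≈⟨ +-congˡ (Σ<-reverse n f) ⟩
    f n + Σ< n (λ i → f (n ∸ suc i))      ≈⟨ Σ<-suc n (λ i → f (suc n ∸ suc i)) ⟨
    Σ< (suc n) (λ i → f (suc n ∸ suc i))  ∎

  Σ<-triangle : ∀ n (g : ℕ → ℕ → Carrier) →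
                Σ< (suc n) (λ j → Σ< (suc j) (λ k → g k j))
                ≈ Σ< (suc n) (λ k → Σ< (suc (n ∸ k)) (λ i → g k (k ℕ.+ i)))
  Σ<-triangle zero    g = refl
  Σ<-triangle (suc n) g = begin
    Σ< (suc n) (λ j → Σ< (suc j) (λ k → g k j)) + Σ< (suc (suc n)) (λ k → g k (suc n))
      ≈⟨ +-congʳ (Σ<-triangle n g) ⟩
    Σ< (suc n) (λ k → row (suc (n ∸ k)) k) + Σ< (suc (suc n)) (λ k → g k (suc n))
      ≈⟨ +-congʳ (Σ<-cong (suc n) (λ k k≤n → reflexive (≡.cong (λ m → row m k)
                                                         (≡.sym (ℕ.+-∸-assoc 1 (ℕ.s≤s⁻¹ k≤n)))))) ⟩
    Σ< (suc n) (λ k → row (suc n ∸ k) k) + Σ< (suc (suc n)) (λ k → g k (suc n))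
      ≈⟨ +-congʳ (trans (+-congˡ (reflexive (≡.cong (λ m → row m (suc n)) (ℕ.n∸n≡0 n)))) (+-identityʳ _)) ⟨
    Σ< (suc (suc n)) (λ k → row (suc n ∸ k) k) + Σ< (suc (suc n)) (λ k → g k (suc n))
      ≈⟨ Σ<-distrib-+ (suc (suc n)) _ _ ⟨
    Σ< (suc (suc n)) (λ k → row (suc n ∸ k) k + g k (suc n))
      ≈⟨ Σ<-cong (suc (suc n)) (λ k k≤1+n → +-congˡ (reflexive (≡.cong (g k)
                                             (≡.sym (ℕ.m+[n∸m]≡n (ℕ.s≤s⁻¹ k≤1+n)))))) ⟩
    Σ< (suc (suc n)) (λ k → row (suc (suc n ∸ k)) k) ∎
    where
    row : ℕ → ℕ → Carrier
    row m k = Σ< m (λ i → g k (k ℕ.+ i))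

  Σ<≈∑ : ∀ n (f : ℕ → Carrier) → Σ< n f ≈ ∑[ i < n ] f (toℕ i)
  Σ<≈∑ zero    f = refl
  Σ<≈∑ (suc n) f = begin
    Σ< n f + f n
      ≈⟨ +-cong (trans (Σ<≈∑ n f) (sum-cong-≋ {n} {f ∘ toℕ} (λ i → reflexive (≡.cong f (≡.sym (toℕ-inject₁ i))))))
                (reflexive (≡.cong f (≡.sym (toℕ-fromℕ n)))) ⟩
    ∑[ i < n ] f (toℕ (inject₁ i)) + f (toℕ (fromℕ n))
      ≈⟨ sum-init-last (f ∘ toℕ) ⟨
    ∑[ i < suc n ] f (toℕ i) ∎

  -- A series u stands for Σₖ u k · tᵏ; _⊛_ is the Cauchy product and dilate s u is u(s t).
  Series : Set c
  Series = ℕ → Carrier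

  infix 4 _≋_
  _≋_ : Series → Series → Set ℓ
  u ≋ v = ∀ n → u n ≈ v n

  ≋-isEquivalence : IsEquivalence _≋_
  ≋-isEquivalence = record
    { refl  = λ _ → refl
    ; sym   = λ u≋v n → sym (u≋v n)
    ; trans = λ u≋v v≋w n → trans (u≋v n) (v≋w n)
    }

  infixl 7 _⊛_
  _⊛_ : Series → Series → Series
  (u ⊛ v) n = Σ< (suc n) (λ k → u k * v (n ∸ k))

  ⊛-cong : ∀ {u u′ v v′} → u ≋ u′ → v ≋ v′ → u ⊛ v ≋ u′ ⊛ v′
  ⊛-cong u≋u′ v≋v′ n = Σ<-cong (suc n) (λ k _ → *-cong (u≋u′ k) (v≋v′ (n ∸ k)))

  ⊛-comm : ∀ u v → u ⊛ v ≋ v ⊛ u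
  ⊛-comm u v n = begin
    Σ< (suc n) (λ k → u k * v (n ∸ k))              ≈⟨ Σ<-reverse (suc n) _ ⟩
    Σ< (suc n) (λ i → u (n ∸ i) * v (n ∸ (n ∸ i)))  ≈⟨ Σ<-cong (suc n) (λ i i≤n →
        trans (*-comm _ _) (*-congʳ (reflexive (≡.cong v (ℕ.m∸[m∸n]≡n (ℕ.s≤s⁻¹ i≤n)))))) ⟩
    Σ< (suc n) (λ i → v i * u (n ∸ i))              ∎

  ⊛-assoc : ∀ u v w → (u ⊛ v) ⊛ w ≋ u ⊛ (v ⊛ w)
  ⊛-assoc u v w n = begin
    Σ< (suc n) (λ j → Σ< (suc j) (λ k → u k * v (j ∸ k)) * w (n ∸ j))
      ≈⟨ Σ<-cong (suc n) (λ j _ → *-distribʳ-Σ< (suc j) (w (n ∸ j)) _) ⟩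
    Σ< (suc n) (λ j → Σ< (suc j) (λ k → u k * v (j ∸ k) * w (n ∸ j)))
      ≈⟨ Σ<-triangle n (λ k j → u k * v (j ∸ k) * w (n ∸ j)) ⟩
    Σ< (suc n) (λ k → Σ< (suc (n ∸ k)) (λ i → u k * v (k ℕ.+ i ∸ k) * w (n ∸ (k ℕ.+ i))))
      ≈⟨ Σ<-cong (suc n) (λ k _ → Σ<-cong (suc (n ∸ k)) (λ i _ → trans (*-assoc _ _ _)
           (*-congˡ (*-cong (reflexive (≡.cong v (ℕ.m+n∸m≡n k i)))
                            (reflexive (≡.cong w (≡.sym (ℕ.∸-+-assoc n k i)))))))) ⟩
    Σ< (suc n) (λ k → Σ< (suc (n ∸ k)) (λ i → u k * (v i * w (n ∸ k ∸ i))))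
      ≈⟨ Σ<-cong (suc n) (λ k _ → *-distribˡ-Σ< (suc (n ∸ k)) (u k) _) ⟨
    Σ< (suc n) (λ k → u k * Σ< (suc (n ∸ k)) (λ i → v i * w (n ∸ k ∸ i))) ∎

  ⊛-commutativeSemigroup : CommutativeSemigroup c ℓ
  ⊛-commutativeSemigroup = record
    { _≈_ = _≋_
    ; _∙_ = _⊛_
    ; isCommutativeSemigroup = record
      { isSemigroup = record
        { isMagma = record { isEquivalence = ≋-isEquivalence ; ∙-cong = ⊛-cong }
        ; assoc   = ⊛-assoc
        }
      ; comm = ⊛-comm
      }
    }

  open IsEquivalence ≋-isEquivalence using () renaming (trans to ≋-trans)
  open CommutativeSemigroupProperties ⊛-commutativeSemigroup using ()
    renaming (interchange to ⊛-interchange; x∙yz≈x∙zy to ⊛-x∙yz≈x∙zy; x∙yz≈y∙xz to ⊛-x∙yz≈y∙xz)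

  ⊛-congˡ : ∀ u {v v′} → v ≋ v′ → u ⊛ v ≋ u ⊛ v′
  ⊛-congˡ u v≋v′ = ⊛-cong {u} {u} (λ _ → refl) v≋v′

  ⊛-congʳ : ∀ v {u u′} → u ≋ u′ → u ⊛ v ≋ u′ ⊛ v
  ⊛-congʳ v u≋u′ = ⊛-cong {v = v} {v} u≋u′ (λ _ → refl)

  ⊛-head : ∀ u v → (u ⊛ v) 0 ≈ u 0 * v 0
  ⊛-head u v = +-identityˡ (u 0 * v 0)

  ⊛-cancelʳ : ∀ {u v w} → w 0 ≈ 1# → u ⊛ w ≋ v ⊛ w → u ≋ v
  ⊛-cancelʳ {u} {v} {w} w₀≈1 u⊛w≋v⊛w n = agree-below (suc n) n (ℕ.n<1+n n)
    where
    agree-below : ∀ N i → i < N → u i ≈ v i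
    agree-below (suc N) i i<1+N with ℕ.m<1+n⇒m<n∨m≡n i<1+N
    ... | inj₁ i<N    = agree-below N i i<N
    ... | inj₂ ≡.refl = begin
      u i                      ≈⟨ *-identityʳ (u i) ⟨
      u i * 1#                 ≈⟨ *-congˡ w[i∸i]≈1 ⟨
      u i * w (i ∸ i)          ≈⟨ +-cancelˡ (Σ< i (λ k → v k * w (i ∸ k))) _ _ (begin
        Σ< i (λ k → v k * w (i ∸ k)) + u i * w (i ∸ i)
          ≈⟨ +-congʳ (Σ<-cong i (λ k k<i → *-congʳ (agree-below i k k<i))) ⟨
        (u ⊛ w) i              ≈⟨ u⊛w≋v⊛w i ⟩
        (v ⊛ w) i              ∎) ⟩
      v i * w (i ∸ i)          ≈⟨ *-congˡ w[i∸i]≈1 ⟩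
      v i * 1#                 ≈⟨ *-identityʳ (v i) ⟩
      v i                      ∎
      where
      w[i∸i]≈1 : w (i ∸ i) ≈ 1#
      w[i∸i]≈1 = trans (reflexive (≡.cong w (ℕ.n∸n≡0 i))) w₀≈1

  dilate : Carrier → Series → Series
  dilate s u k = s ^ k * u k

  dilate-congˡ : ∀ s {u v} → u ≋ v → dilate s u ≋ dilate s v
  dilate-congˡ s u≋v k = *-congˡ (u≋v k)

  dilate-congʳ : ∀ u {s t} → s ≈ t → dilate s u ≋ dilate t u
  dilate-congʳ u s≈t k = *-congʳ (^-cong k s≈t)

  dilate-⊛ : ∀ s u v → dilate s u ⊛ dilate s v ≋ dilate s (u ⊛ v)
  dilate-⊛ s u v n = begin
    Σ< (suc n) (λ k → s ^ k * u k * (s ^ (n ∸ k) * v (n ∸ k)))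
      ≈⟨ Σ<-cong (suc n) (λ k k≤n → trans
           (solve 4 (λ a b x y → a :* b :* (x :* y) := a :* x :* (b :* y)) refl (s ^ k) (u k) (s ^ (n ∸ k)) (v (n ∸ k)))
           (*-congʳ (^-split s (ℕ.s≤s⁻¹ k≤n)))) ⟩
    Σ< (suc n) (λ k → s ^ n * (u k * v (n ∸ k)))
      ≈⟨ *-distribˡ-Σ< (suc n) (s ^ n) _ ⟨
    s ^ n * (u ⊛ v) n ∎

  dilate-dilate : ∀ s t u → dilate s (dilate t u) ≋ dilate (s * t) u
  dilate-dilate s t u k = trans (sym (*-assoc _ _ _)) (*-congʳ (sym (^-distribʳ-* s t k)))

  module _ (ι-hom : IsQAlgebraMap R ι) where

    open RingMorphisms.IsRingHomomorphism ι-hom using (+-homo; *-homo; 0#-homo; 1#-homo)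
      renaming (⟦⟧-cong to ι-cong)

    ⟨suc⟩ : ∀ n → ⟨ suc n ⟩ ≈ 1# + ⟨ n ⟩
    ⟨suc⟩ n = trans (ι-cong ([1+n]/1≡1+n/1 n)) (trans (+-homo 1ℚ (+ n / 1)) (+-congʳ 1#-homo))

    ⟨⟩≈·1# : ∀ n → ⟨ n ⟩ ≈ n · 1#
    ⟨⟩≈·1# zero    = 0#-homo
    ⟨⟩≈·1# (suc n) = trans (⟨suc⟩ n) (+-congˡ (⟨⟩≈·1# n))

    ⟨+⟩ : ∀ m n → ⟨ m ℕ.+ n ⟩ ≈ ⟨ m ⟩ + ⟨ n ⟩
    ⟨+⟩ m n = trans (⟨⟩≈·1# (m ℕ.+ n)) (trans (×-homo-+ 1# m n) (sym (+-cong (⟨⟩≈·1# m) (⟨⟩≈·1# n))))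

    ⟨*⟩ : ∀ m n → ⟨ m ℕ.* n ⟩ ≈ ⟨ m ⟩ * ⟨ n ⟩
    ⟨*⟩ m n = trans (⟨⟩≈·1# (m ℕ.* n)) (trans (×1-homo-* m n) (sym (*-cong (⟨⟩≈·1# m) (⟨⟩≈·1# n))))

    ⟨^⟩ : ∀ m k → ⟨ m ℕ.^ k ⟩ ≈ ⟨ m ⟩ ^ k
    ⟨^⟩ m zero    = 1#-homo
    ⟨^⟩ m (suc k) = trans (⟨*⟩ m (m ℕ.^ k)) (*-congˡ (⟨^⟩ m k))

    ·≈⟨⟩* : ∀ m x → m · x ≈ ⟨ m ⟩ * x
    ·≈⟨⟩* m x = begin
      m · x         ≈⟨ ×-congʳ m (*-identityˡ x) ⟨
      m · (1# * x)  ≈⟨ ×-assoc-* m 1# x ⟨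
      m · 1# * x    ≈⟨ *-congʳ (⟨⟩≈·1# m) ⟨
      ⟨ m ⟩ * x     ∎

    _⁻¹ : (q : ℕ) → .{{NonZero q}} → Carrier
    q ⁻¹ = ι (+ 1 / q)

    ⟨⟩*ι/ : ∀ p q .{{_ : NonZero q}} → ⟨ q ⟩ * ι (+ p / q) ≈ ⟨ p ⟩
    ⟨⟩*ι/ p q = trans (sym (*-homo (+ q / 1) (+ p / q))) (ι-cong (q/1*p/q≡p/1 p q))

    ⟨⟩*⁻¹ : ∀ q .{{_ : NonZero q}} → ⟨ q ⟩ * q ⁻¹ ≈ 1#
    ⟨⟩*⁻¹ q = trans (⟨⟩*ι/ 1 q) 1#-homo

    ⟨⟩-cancelˡ : ∀ q .{{_ : NonZero q}} {x y} → ⟨ q ⟩ * x ≈ ⟨ q ⟩ * y → x ≈ y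
    ⟨⟩-cancelˡ q {x} {y} qx≈qy = begin
      x                    ≈⟨ *-identityˡ x ⟨
      1# * x               ≈⟨ *-congʳ (trans (*-comm _ _) (⟨⟩*⁻¹ q)) ⟨
      q ⁻¹ * ⟨ q ⟩ * x     ≈⟨ *-assoc _ _ _ ⟩
      q ⁻¹ * (⟨ q ⟩ * x)   ≈⟨ *-congˡ qx≈qy ⟩
      q ⁻¹ * (⟨ q ⟩ * y)   ≈⟨ *-assoc _ _ _ ⟨
      q ⁻¹ * ⟨ q ⟩ * y     ≈⟨ *-congʳ (trans (*-comm _ _) (⟨⟩*⁻¹ q)) ⟩
      1# * y               ≈⟨ *-identityˡ y ⟩
      y                    ∎

    ι/≈⟨⟩*⁻¹ : ∀ p q .{{_ : NonZero q}} → ι (+ p / q) ≈ ⟨ p ⟩ * q ⁻¹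
    ι/≈⟨⟩*⁻¹ p q = ⟨⟩-cancelˡ q (begin
      ⟨ q ⟩ * ι (+ p / q)    ≈⟨ ⟨⟩*ι/ p q ⟩
      ⟨ p ⟩                  ≈⟨ *-identityʳ (⟨ p ⟩) ⟨
      ⟨ p ⟩ * 1#             ≈⟨ *-congˡ (⟨⟩*⁻¹ q) ⟨
      ⟨ p ⟩ * (⟨ q ⟩ * q ⁻¹)  ≈⟨ x∙yz≈y∙xz (⟨ p ⟩) (⟨ q ⟩) (q ⁻¹) ⟩
      ⟨ q ⟩ * (⟨ p ⟩ * q ⁻¹)  ∎)

    ⟨⟩*⁻¹-cancel : ∀ p {q r} .{{_ : NonZero q}} .{{_ : NonZero r}} → p ℕ.* q ≡ r → ⟨ p ⟩ * r ⁻¹ ≈ q ⁻¹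
    ⟨⟩*⁻¹-cancel p {q} {r} p*q≡r = ⟨⟩-cancelˡ q (begin
      ⟨ q ⟩ * (⟨ p ⟩ * r ⁻¹)  ≈⟨ x∙yz≈y∙xz (⟨ q ⟩) (⟨ p ⟩) (r ⁻¹) ⟩
      ⟨ p ⟩ * (⟨ q ⟩ * r ⁻¹)  ≈⟨ *-assoc _ _ _ ⟨
      ⟨ p ⟩ * ⟨ q ⟩ * r ⁻¹    ≈⟨ *-congʳ (trans (sym (⟨*⟩ p q)) (reflexive (≡.cong ⟨_⟩ p*q≡r))) ⟩
      ⟨ r ⟩ * r ⁻¹            ≈⟨ ⟨⟩*⁻¹ r ⟩
      1#                     ≈⟨ ⟨⟩*⁻¹ q ⟨
      ⟨ q ⟩ * q ⁻¹            ∎)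

    ⁻¹-homo-* : ∀ p q .{{_ : NonZero p}} .{{_ : NonZero q}} → ((p ℕ.* q) ⁻¹) {{ℕ.m*n≢0 p q}} ≈ p ⁻¹ * q ⁻¹
    ⁻¹-homo-* p q = ⟨⟩-cancelˡ (p ℕ.* q) (begin
      ⟨ p ℕ.* q ⟩ * (p ℕ.* q) ⁻¹      ≈⟨ ⟨⟩*⁻¹ (p ℕ.* q) ⟩
      1#                             ≈⟨ *-identityˡ 1# ⟨
      1# * 1#                        ≈⟨ *-cong (⟨⟩*⁻¹ p) (⟨⟩*⁻¹ q) ⟨
      ⟨ p ⟩ * p ⁻¹ * (⟨ q ⟩ * q ⁻¹)   ≈⟨ solve 4 (λ a b x y → a :* b :* (x :* y) := a :* x :* (b :* y))
                                              refl (⟨ p ⟩) (p ⁻¹) (⟨ q ⟩) (q ⁻¹) ⟩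
      ⟨ p ⟩ * ⟨ q ⟩ * (p ⁻¹ * q ⁻¹)   ≈⟨ *-congʳ (⟨*⟩ p q) ⟨
      ⟨ p ℕ.* q ⟩ * (p ⁻¹ * q ⁻¹)     ∎)
      where instance
      p*q≢0 : NonZero (p ℕ.* q)
      p*q≢0 = ℕ.m*n≢0 p q

    infix 10 _!⁻¹
    _!⁻¹ : ℕ → Carrier
    n !⁻¹ = ((n !) ⁻¹) {{n ℕ.!≢0}}

    ⟨1+n⟩*[1+n]!⁻¹ : ∀ n → ⟨ suc n ⟩ * suc n !⁻¹ ≈ n !⁻¹
    ⟨1+n⟩*[1+n]!⁻¹ n = ⟨⟩*⁻¹-cancel (suc n) {{n ℕ.!≢0}} {{suc n ℕ.!≢0}} ≡.refl

    ⟨nCk⟩*n!⁻¹ : ∀ {n k} → k ≤ n → ⟨ n C k ⟩ * n !⁻¹ ≈ k !⁻¹ * (n ∸ k) !⁻¹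
    ⟨nCk⟩*n!⁻¹ {n} {k} k≤n =
      trans (⟨⟩*⁻¹-cancel (n C k) {{k ℕ.!* (n ∸ k) !≢0}} {{n ℕ.!≢0}} (nCk*[k!*[n∸k]!]≡n! k≤n))
            (⁻¹-homo-* (k !) ((n ∸ k) !) {{k ℕ.!≢0}} {{(n ∸ k) ℕ.!≢0}})

    ⟨multinom⟩*n!⁻¹ : ∀ {n k l} → k ≤ n → l ≤ n ∸ k →
                      ⟨ multinom n k l ⟩ * n !⁻¹ ≈ k !⁻¹ * (l !⁻¹ * (n ∸ k ∸ l) !⁻¹)
    ⟨multinom⟩*n!⁻¹ {n} {k} {l} k≤n l≤n∸k = begin
      ⟨ multinom n k l ⟩ * n !⁻¹
        ≈⟨ ⟨⟩*⁻¹-cancel (multinom n k l) {{k!*[l!*m!]≢0}} {{n ℕ.!≢0}} (multinom*[k!*[l!*m!]]≡n! k≤n l≤n∸k) ⟩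
      ((k ! ℕ.* (l ! ℕ.* m !)) ⁻¹) {{k!*[l!*m!]≢0}}
        ≈⟨ ⁻¹-homo-* (k !) (l ! ℕ.* m !) {{k ℕ.!≢0}} {{l ℕ.!* m !≢0}} ⟩
      k !⁻¹ * ((l ! ℕ.* m !) ⁻¹) {{l ℕ.!* m !≢0}}
        ≈⟨ *-congˡ (⁻¹-homo-* (l !) (m !) {{l ℕ.!≢0}} {{m ℕ.!≢0}}) ⟩
      k !⁻¹ * (l !⁻¹ * m !⁻¹) ∎
      where
      m = n ∸ k ∸ l
      k!*[l!*m!]≢0 = ℕ.m*n≢0 (k !) (l ! ℕ.* m !) {{k ℕ.!≢0}} {{l ℕ.!* m !≢0}}

    binomial : ∀ n u → Σ< (suc n) (λ k → ⟨ n C k ⟩ * u ^ k) ≈ (1# + u) ^ n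
    binomial n u = begin
      Σ< (suc n) (λ k → ⟨ n C k ⟩ * u ^ k)
        ≈⟨ Σ<≈∑ (suc n) _ ⟩
      ∑[ k < suc n ] (⟨ n C toℕ k ⟩ * u ^ toℕ k)
        ≈⟨ sum-cong-≋ {suc n} {λ k → ⟨ n C toℕ k ⟩ * u ^ toℕ k} (λ k → term (toℕ k)) ⟩
      binomialExpansion u 1# n
        ≈⟨ theorem n u 1# ⟨
      (u + 1#) ^ˢ n
        ≡⟨ ^≡^ˢ (u + 1#) n ⟨
      (u + 1#) ^ n
        ≈⟨ ^-cong n (+-comm u 1#) ⟩
      (1# + u) ^ n ∎
      where
      open BinomialTheorem commutativeSemiring using (binomialExpansion; theorem)
      1^≈1 : ∀ m → 1# ^ˢ m ≈ 1#
      1^≈1 zero    = refl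
      1^≈1 (suc m) = trans (*-identityˡ _) (1^≈1 m)
      term : ∀ k → ⟨ n C k ⟩ * u ^ k ≈ (n C k) · (u ^ˢ k * 1# ^ˢ (n ∸ k))
      term k = begin
        ⟨ n C k ⟩ * u ^ k                        ≈⟨ ·≈⟨⟩* (n C k) (u ^ k) ⟨
        (n C k) · u ^ k                          ≈⟨ ×-congʳ (n C k) (trans (reflexive (^≡^ˢ u k))
                                                     (sym (trans (*-congˡ (1^≈1 (n ∸ k))) (*-identityʳ _)))) ⟩
        (n C k) · (u ^ˢ k * 1# ^ˢ (n ∸ k))       ∎

    egf : (ℕ → Carrier) → Series
    egf a k = a k * k !⁻¹

    egf-injective : ∀ {a b} → egf a ≋ egf b → ∀ n → a n ≈ b n
    egf-injective {a} {b} egf[a]≋egf[b] n = begin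
      a n                      ≈⟨ *-identityʳ (a n) ⟨
      a n * 1#                 ≈⟨ *-congˡ n!⁻¹*⟨n!⟩≈1 ⟨
      a n * (n !⁻¹ * ⟨ n ! ⟩)   ≈⟨ *-assoc _ _ _ ⟨
      egf a n * ⟨ n ! ⟩         ≈⟨ *-congʳ (egf[a]≋egf[b] n) ⟩
      egf b n * ⟨ n ! ⟩         ≈⟨ *-assoc _ _ _ ⟩
      b n * (n !⁻¹ * ⟨ n ! ⟩)   ≈⟨ *-congˡ n!⁻¹*⟨n!⟩≈1 ⟩
      b n * 1#                 ≈⟨ *-identityʳ (b n) ⟩
      b n                      ∎
      where
      n!⁻¹*⟨n!⟩≈1 : n !⁻¹ * ⟨ n ! ⟩ ≈ 1#
      n!⁻¹*⟨n!⟩≈1 = trans (*-comm _ _) (⟨⟩*⁻¹ (n !) {{n ℕ.!≢0}})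

    eᵗ : Series
    eᵗ k = k !⁻¹

    [eᵗ-1]/t : Series
    [eᵗ-1]/t k = suc k !⁻¹

    egf⊛[eᵗ-1]/t : ∀ a n → (egf a ⊛ [eᵗ-1]/t) n ≈ Σ< (suc n) (λ m → ⟨ suc n C m ⟩ * a m) * suc n !⁻¹
    egf⊛[eᵗ-1]/t a n = begin
      Σ< (suc n) (λ m → a m * m !⁻¹ * suc (n ∸ m) !⁻¹)
        ≈⟨ Σ<-cong (suc n) (λ m m≤n → term m (ℕ.s≤s⁻¹ m≤n)) ⟩
      Σ< (suc n) (λ m → ⟨ suc n C m ⟩ * a m * suc n !⁻¹)
        ≈⟨ *-distribʳ-Σ< (suc n) (suc n !⁻¹) _ ⟨
      Σ< (suc n) (λ m → ⟨ suc n C m ⟩ * a m) * suc n !⁻¹ ∎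
      where
      term : ∀ m → m ≤ n → a m * m !⁻¹ * suc (n ∸ m) !⁻¹ ≈ ⟨ suc n C m ⟩ * a m * suc n !⁻¹
      term m m≤n = begin
        a m * m !⁻¹ * suc (n ∸ m) !⁻¹       ≡⟨ ≡.cong (λ j → a m * m !⁻¹ * j !⁻¹) (ℕ.+-∸-assoc 1 m≤n) ⟨
        a m * m !⁻¹ * (suc n ∸ m) !⁻¹       ≈⟨ *-assoc _ _ _ ⟩
        a m * (m !⁻¹ * (suc n ∸ m) !⁻¹)     ≈⟨ *-congˡ (⟨nCk⟩*n!⁻¹ (ℕ.m≤n⇒m≤1+n m≤n)) ⟨
        a m * (⟨ suc n C m ⟩ * suc n !⁻¹)   ≈⟨ *-assoc _ _ _ ⟨
        a m * ⟨ suc n C m ⟩ * suc n !⁻¹     ≈⟨ *-congʳ (*-comm _ _) ⟩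
        ⟨ suc n C m ⟩ * a m * suc n !⁻¹     ∎

    bernoulliCoefficient : ℕ → ℕ → Carrier
    bernoulliCoefficient n j = ι (+ (suc n C j) / suc n)

    -- The sum used by `bernVec` is local to `Defs`. This meta names it: the `with` abstractions in
    -- `bernVec-suc` turn all its arguments into distinct variables, so unification solves it.
    mutual
      bernVecSum : ℕ → Carrier → (m : ℕ) → (Fin m → Carrier) → Carrier
      bernVecSum = _

      bernVec-suc : ∀ n x → let F = λ j → bernoulliCoefficient (suc n) (toℕ j) * lookup (bernVec (suc n) x) j in
        bernVec (suc (suc n)) x ≡ bernVec (suc n) x ∷ʳ (x ^ suc n - (bernVecSum (suc n) x n (F ∘ inject₁) + F (fromℕ n)))
      bernVec-suc n x with bernVec (suc n) x
      ... | V with (λ (j : Fin n) → bernoulliCoefficient (suc n) (toℕ (inject₁ j)) * lookup V (inject₁ j))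
      ... | _ with bernoulliCoefficient (suc n) (toℕ (fromℕ n)) * lookup V (fromℕ n)
      ... | _ with suc n
      ... | _ = ≡.refl

    bernVecSum≈Σ< : ∀ n x m (f : Fin m → Carrier) (g : ℕ → Carrier) →
                    (∀ j → f j ≈ g (toℕ j)) → bernVecSum n x m f ≈ Σ< m g
    bernVecSum≈Σ< n x zero    f g f≈g = refl
    bernVecSum≈Σ< n x (suc m) f g f≈g = +-cong
      (bernVecSum≈Σ< n x m (f ∘ inject₁) g (λ j → trans (f≈g (inject₁ j)) (reflexive (≡.cong g (toℕ-inject₁ j)))))
      (trans (f≈g (fromℕ m)) (reflexive (≡.cong g (toℕ-fromℕ m))))

    lookup-bernVec : ∀ n x (j : Fin n) → lookup (bernVec n x) j ≡ B (toℕ j) x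
    lookup-bernVec (suc n) x j with view j
    ... | ‵fromℕ     = ≡.cong (λ i → B i x) (≡.sym (toℕ-fromℕ n))
    ... | ‵inject₁ i = ≡.trans (lookup-∷ʳ-inject₁ (bernVec n x) _ i)
                      (≡.trans (lookup-bernVec n x i) (≡.cong (λ k → B k x) (≡.sym (toℕ-inject₁ i))))

    B-recurrence : ∀ n x → B n x ≈ x ^ n - Σ< n (λ j → bernoulliCoefficient n j * B j x)
    B-recurrence zero    x = refl
    B-recurrence (suc n) x = begin
      B (suc n) x
        ≡⟨ ≡.cong (λ v → lookup v (fromℕ (suc n))) (bernVec-suc n x) ⟩
      lookup (bernVec (suc n) x ∷ʳ (x ^ suc n - bernVecSum (suc n) x (suc n) F)) (fromℕ (suc n))
        ≡⟨ lookup-∷ʳ-fromℕ (bernVec (suc n) x) _ ⟩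
      x ^ suc n - bernVecSum (suc n) x (suc n) F
        ≈⟨ +-congˡ (-‿cong (bernVecSum≈Σ< (suc n) x (suc n) F _
             (λ j → *-congˡ (reflexive (lookup-bernVec (suc n) x j))))) ⟩
      x ^ suc n - Σ< (suc n) (λ j → bernoulliCoefficient (suc n) j * B j x) ∎
      where
      F : Fin (suc n) → Carrier
      F j = bernoulliCoefficient (suc n) (toℕ j) * lookup (bernVec (suc n) x) j

    bernoulli-sum : ∀ n x → Σ< (suc n) (λ j → ⟨ suc n C j ⟩ * B j x) ≈ ⟨ suc n ⟩ * x ^ n
    bernoulli-sum n x = begin
      Σ< n (λ j → ⟨ suc n C j ⟩ * B j x) + ⟨ suc n C n ⟩ * B n x
        ≈⟨ +-cong (Σ<-cong n (λ j _ → trans (*-congʳ (sym (⟨⟩*ι/ (suc n C j) (suc n)))) (*-assoc _ _ _)))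
                  (*-congʳ (reflexive (≡.cong ⟨_⟩ [1+n]Cn≡1+n))) ⟩
      Σ< n (λ j → ⟨ suc n ⟩ * (bernoulliCoefficient n j * B j x)) + ⟨ suc n ⟩ * B n x
        ≈⟨ +-congʳ (*-distribˡ-Σ< n (⟨ suc n ⟩) _) ⟨
      ⟨ suc n ⟩ * Q + ⟨ suc n ⟩ * B n x
        ≈⟨ distribˡ _ _ _ ⟨
      ⟨ suc n ⟩ * (Q + B n x)
        ≈⟨ *-congˡ (trans (+-congˡ (B-recurrence n x)) (trans (sym (+-assoc Q (x ^ n) (- Q))) (xyx⁻¹≈y Q (x ^ n)))) ⟩
      ⟨ suc n ⟩ * x ^ n ∎
      where
      Q = Σ< n (λ j → bernoulliCoefficient n j * B j x)
      [1+n]Cn≡1+n : suc n C n ≡ suc n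
      [1+n]Cn≡1+n = ≡.trans (nCk≡nC[n∸k] (ℕ.n≤1+n n))
                             (≡.trans (≡.cong (suc n C_) (ℕ.m+n∸n≡m 1 n)) (nC1≡n (suc n)))

    bernoulliEGF : Carrier → Series
    bernoulliEGF x = egf (λ k → B k x)

    bernoulliEGF⊛[eᵗ-1]/t : ∀ x → bernoulliEGF x ⊛ [eᵗ-1]/t ≋ dilate x eᵗ
    bernoulliEGF⊛[eᵗ-1]/t x n = begin
      (bernoulliEGF x ⊛ [eᵗ-1]/t) n            ≈⟨ egf⊛[eᵗ-1]/t (λ k → B k x) n ⟩
      Σ< (suc n) (λ j → ⟨ suc n C j ⟩ * B j x) * suc n !⁻¹ ≈⟨ *-congʳ (bernoulli-sum n x) ⟩
      ⟨ suc n ⟩ * x ^ n * suc n !⁻¹           ≈⟨ *-congʳ (*-comm _ _) ⟩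
      x ^ n * ⟨ suc n ⟩ * suc n !⁻¹           ≈⟨ *-assoc _ _ _ ⟩
      x ^ n * (⟨ suc n ⟩ * suc n !⁻¹)         ≈⟨ *-congˡ (⟨1+n⟩*[1+n]!⁻¹ n) ⟩
      x ^ n * n !⁻¹                           ∎

    binomial-last : ∀ n u → Σ< (suc n) (λ m → ⟨ suc n C m ⟩ * u ^ m) + u ^ suc n ≈ (1# + u) ^ suc n
    binomial-last n u = trans (+-congˡ (sym ⟨[1+n]C[1+n]⟩*u^[1+n])) (binomial (suc n) u)
      where
      ⟨[1+n]C[1+n]⟩*u^[1+n] : ⟨ suc n C suc n ⟩ * u ^ suc n ≈ u ^ suc n
      ⟨[1+n]C[1+n]⟩*u^[1+n] =
        trans (*-congʳ (trans (reflexive (≡.cong ⟨_⟩ (nCn≡1 (suc n)))) 1#-homo)) (*-identityˡ _)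

    powerSum-binomial : ∀ N n → Σ< (suc n) (λ m → ⟨ suc n C m ⟩ * ⟨ S m N ⟩) ≈ ⟨ suc N ⟩ ^ suc n
    powerSum-binomial zero n = begin
      Σ< (suc n) (λ m → ⟨ suc n C m ⟩ * ⟨ 0 ℕ.^ m ⟩)
        ≈⟨ +-identityʳ _ ⟨
      Σ< (suc n) (λ m → ⟨ suc n C m ⟩ * ⟨ 0 ℕ.^ m ⟩) + 0#
        ≈⟨ +-cong (Σ<-cong (suc n) (λ m _ → *-congˡ (⟨^⟩ 0 m))) (sym (zeroˡ _)) ⟩
      Σ< (suc n) (λ m → ⟨ suc n C m ⟩ * ⟨ 0 ⟩ ^ m) + 0# * ⟨ 0 ⟩ ^ n
        ≈⟨ +-congˡ (*-congʳ 0#-homo) ⟨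
      Σ< (suc n) (λ m → ⟨ suc n C m ⟩ * ⟨ 0 ⟩ ^ m) + ⟨ 0 ⟩ ^ suc n
        ≈⟨ binomial-last n (⟨ 0 ⟩) ⟩
      (1# + ⟨ 0 ⟩) ^ suc n
        ≈⟨ ^-cong (suc n) (⟨suc⟩ 0) ⟨
      ⟨ 1 ⟩ ^ suc n ∎
    powerSum-binomial (suc N) n = begin
      Σ< (suc n) (λ m → ⟨ suc n C m ⟩ * ⟨ S m N ℕ.+ suc N ℕ.^ m ⟩)
        ≈⟨ Σ<-cong (suc n) (λ m _ → trans (*-congˡ (trans (⟨+⟩ (S m N) (suc N ℕ.^ m)) (+-congˡ (⟨^⟩ (suc N) m))))
                                          (distribˡ _ _ _)) ⟩
      Σ< (suc n) (λ m → ⟨ suc n C m ⟩ * ⟨ S m N ⟩ + ⟨ suc n C m ⟩ * ⟨ suc N ⟩ ^ m)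
        ≈⟨ Σ<-distrib-+ (suc n) _ _ ⟩
      Σ< (suc n) (λ m → ⟨ suc n C m ⟩ * ⟨ S m N ⟩) + Σ< (suc n) (λ m → ⟨ suc n C m ⟩ * ⟨ suc N ⟩ ^ m)
        ≈⟨ +-congʳ (powerSum-binomial N n) ⟩
      ⟨ suc N ⟩ ^ suc n + Σ< (suc n) (λ m → ⟨ suc n C m ⟩ * ⟨ suc N ⟩ ^ m)
        ≈⟨ +-comm _ _ ⟩
      Σ< (suc n) (λ m → ⟨ suc n C m ⟩ * ⟨ suc N ⟩ ^ m) + ⟨ suc N ⟩ ^ suc n
        ≈⟨ binomial-last n (⟨ suc N ⟩) ⟩
      (1# + ⟨ suc N ⟩) ^ suc n
        ≈⟨ ^-cong (suc n) (⟨suc⟩ (suc N)) ⟨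
      ⟨ suc (suc N) ⟩ ^ suc n ∎

    -- The factor c⁻¹ is the w₃⁻¹ hidden in the exponent k + ℓ − 1 of w₃.
    powerSumEGF : (c : ℕ) → .{{NonZero c}} → Series
    powerSumEGF c = egf (λ m → c ⁻¹ * ⟨ S m (c ∸ 1) ⟩)

    powerSumEGF⊛[eᵗ-1]/t : ∀ c .{{_ : NonZero c}} → powerSumEGF c ⊛ [eᵗ-1]/t ≋ dilate ⟨ c ⟩ [eᵗ-1]/t
    powerSumEGF⊛[eᵗ-1]/t (suc N) n = begin
      (powerSumEGF (suc N) ⊛ [eᵗ-1]/t) n
        ≈⟨ egf⊛[eᵗ-1]/t _ n ⟩
      Σ< (suc n) (λ m → ⟨ suc n C m ⟩ * (c⁻¹ * ⟨ S m N ⟩)) * suc n !⁻¹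
        ≈⟨ *-congʳ (Σ<-cong (suc n) (λ m _ → x∙yz≈y∙xz _ c⁻¹ _)) ⟩
      Σ< (suc n) (λ m → c⁻¹ * (⟨ suc n C m ⟩ * ⟨ S m N ⟩)) * suc n !⁻¹
        ≈⟨ *-congʳ (*-distribˡ-Σ< (suc n) c⁻¹ _) ⟨
      c⁻¹ * Σ< (suc n) (λ m → ⟨ suc n C m ⟩ * ⟨ S m N ⟩) * suc n !⁻¹
        ≈⟨ *-congʳ (*-congˡ (powerSum-binomial N n)) ⟩
      c⁻¹ * (⟨ suc N ⟩ * ⟨ suc N ⟩ ^ n) * suc n !⁻¹
        ≈⟨ *-congʳ (*-assoc _ _ _) ⟨
      c⁻¹ * ⟨ suc N ⟩ * ⟨ suc N ⟩ ^ n * suc n !⁻¹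
        ≈⟨ *-congʳ (*-congʳ (trans (*-comm _ _) (⟨⟩*⁻¹ (suc N)))) ⟩
      1# * ⟨ suc N ⟩ ^ n * suc n !⁻¹
        ≈⟨ *-congʳ (*-identityˡ _) ⟩
      ⟨ suc N ⟩ ^ n * suc n !⁻¹ ∎
      where
      c⁻¹ = suc N ⁻¹

    [eˢᵗ-1]/st : Carrier → Series
    [eˢᵗ-1]/st s = dilate s [eᵗ-1]/t

    kernel : Carrier → Carrier → Carrier → Series
    kernel s t u = [eˢᵗ-1]/st s ⊛ ([eˢᵗ-1]/st t ⊛ [eˢᵗ-1]/st u)

    kernel-cong : ∀ {s s′ t t′ u u′} → s ≈ s′ → t ≈ t′ → u ≈ u′ → kernel s t u ≋ kernel s′ t′ u′
    kernel-cong s≈s′ t≈t′ u≈u′ = ⊛-cong (D-cong s≈s′) (⊛-cong (D-cong t≈t′) (D-cong u≈u′))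
      where
      D-cong : ∀ {s s′} → s ≈ s′ → [eˢᵗ-1]/st s ≋ [eˢᵗ-1]/st s′
      D-cong = dilate-congʳ [eᵗ-1]/t

    kernel-swap₁₂ : ∀ s t u → kernel s t u ≋ kernel t s u
    kernel-swap₁₂ s t u = ⊛-x∙yz≈y∙xz ([eˢᵗ-1]/st s) ([eˢᵗ-1]/st t) ([eˢᵗ-1]/st u)

    kernel-swap₂₃ : ∀ s t u → kernel s t u ≋ kernel s u t
    kernel-swap₂₃ s t u = ⊛-x∙yz≈x∙zy ([eˢᵗ-1]/st s) ([eˢᵗ-1]/st t) ([eˢᵗ-1]/st u)

    kernel-head : ∀ s t u → kernel s t u 0 ≈ 1#
    kernel-head s t u = begin
      kernel s t u 0              ≈⟨ ⊛-head (D s) (D t ⊛ D u) ⟩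
      D s 0 * (D t ⊛ D u) 0       ≈⟨ *-congˡ (⊛-head (D t) (D u)) ⟩
      D s 0 * (D t 0 * D u 0)     ≈⟨ *-cong (D₀≈1 s) (*-cong (D₀≈1 t) (D₀≈1 u)) ⟩
      1# * (1# * 1#)              ≈⟨ trans (*-identityˡ (1# * 1#)) (*-identityˡ 1#) ⟩
      1#                          ∎
      where
      D = [eˢᵗ-1]/st
      D₀≈1 : ∀ s → D s 0 ≈ 1#
      D₀≈1 _ = trans (*-identityˡ _) 1#-homo

    dilate-bernoulliEGF⊛[eˢᵗ-1]/st : ∀ s x → dilate s (bernoulliEGF x) ⊛ [eˢᵗ-1]/st s ≋ dilate (s * x) eᵗ
    dilate-bernoulliEGF⊛[eˢᵗ-1]/st s x =
      ≋-trans (dilate-⊛ s (bernoulliEGF x) [eᵗ-1]/t)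
     (≋-trans (dilate-congˡ s (bernoulliEGF⊛[eᵗ-1]/t x)) (dilate-dilate s x eᵗ))

    dilate-powerSumEGF⊛[eˢᵗ-1]/st : ∀ s c .{{_ : NonZero c}} →
                                    dilate s (powerSumEGF c) ⊛ [eˢᵗ-1]/st s ≋ [eˢᵗ-1]/st (s * ⟨ c ⟩)
    dilate-powerSumEGF⊛[eˢᵗ-1]/st s c =
      ≋-trans (dilate-⊛ s (powerSumEGF c) [eᵗ-1]/t)
     (≋-trans (dilate-congˡ s (powerSumEGF⊛[eᵗ-1]/t c)) (dilate-dilate s ⟨ c ⟩ [eᵗ-1]/t))

    module _ (a b c : ℕ) .{{_ : NonZero c}} (y₁ y₂ : Carrier) where

      private
        summand : ℕ → ℕ → ℕ → Carrier
        summand n k l = ι (+ (multinom n k l ℕ.* S m (c ∸ 1) ℕ.* a ℕ.^ (l ℕ.+ m) ℕ.* b ℕ.^ (k ℕ.+ m)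
                              ℕ.* c ℕ.^ (k ℕ.+ l)) / c)
                        * (B k (⟨ a ⟩ * y₁) * B l (⟨ b ⟩ * y₂))
          where m = n ∸ k ∸ l

        U V W : Series
        U = dilate (⟨ b ⟩ * ⟨ c ⟩) (bernoulliEGF (⟨ a ⟩ * y₁))
        V = dilate (⟨ a ⟩ * ⟨ c ⟩) (bernoulliEGF (⟨ b ⟩ * y₂))
        W = dilate (⟨ a ⟩ * ⟨ b ⟩) (powerSumEGF c)

      summand*n!⁻¹ : ∀ {n k l} → k ≤ n → l ≤ n ∸ k → summand n k l * n !⁻¹ ≈ U k * (V l * W (n ∸ k ∸ l))
      summand*n!⁻¹ {n} {k} {l} k≤n l≤n∸k = begin
        ι (+ N / c) * (Bₖ * Bₗ) * n !⁻¹
          ≈⟨ *-congʳ (*-congʳ (trans (ι/≈⟨⟩*⁻¹ N c) (*-congʳ ⟨N⟩≈))) ⟩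
        ⟨ M ⟩ * ⟨ Sₘ ⟩ * ⟨ a ⟩ ^ (l ℕ.+ m) * ⟨ b ⟩ ^ (k ℕ.+ m) * ⟨ c ⟩ ^ (k ℕ.+ l) * c ⁻¹ * (Bₖ * Bₗ) * n !⁻¹
          ≈⟨ solve 9 (λ μ σ α β γ κ p q φ → μ :* σ :* α :* β :* γ :* κ :* (p :* q) :* φ
                                           := μ :* φ :* (α :* β :* γ :* (σ :* κ :* p :* q)))
                   refl (⟨ M ⟩) (⟨ Sₘ ⟩) (⟨ a ⟩ ^ (l ℕ.+ m)) (⟨ b ⟩ ^ (k ℕ.+ m)) (⟨ c ⟩ ^ (k ℕ.+ l))
                   (c ⁻¹) Bₖ Bₗ (n !⁻¹) ⟩
        ⟨ M ⟩ * n !⁻¹ * (⟨ a ⟩ ^ (l ℕ.+ m) * ⟨ b ⟩ ^ (k ℕ.+ m) * ⟨ c ⟩ ^ (k ℕ.+ l) * (⟨ Sₘ ⟩ * c ⁻¹ * Bₖ * Bₗ))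
          ≈⟨ *-cong (⟨multinom⟩*n!⁻¹ k≤n l≤n∸k)
                    (*-congʳ (x^[l+m]y^[k+m]z^[k+l]≈[yz]^k[xz]^l[xy]^m (⟨ a ⟩) (⟨ b ⟩) (⟨ c ⟩) k l m)) ⟩
        k !⁻¹ * (l !⁻¹ * m !⁻¹) * ((⟨ b ⟩ * ⟨ c ⟩) ^ k * ((⟨ a ⟩ * ⟨ c ⟩) ^ l * (⟨ a ⟩ * ⟨ b ⟩) ^ m)
                                    * (⟨ Sₘ ⟩ * c ⁻¹ * Bₖ * Bₗ))
          ≈⟨ solve 10 (λ φₖ φₗ φₘ πₖ πₗ πₘ σ κ p q → φₖ :* (φₗ :* φₘ) :* (πₖ :* (πₗ :* πₘ) :* (σ :* κ :* p :* q))
                                                  := πₖ :* (p :* φₖ) :* (πₗ :* (q :* φₗ) :* (πₘ :* (κ :* σ :* φₘ))))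
                    refl (k !⁻¹) (l !⁻¹) (m !⁻¹) ((⟨ b ⟩ * ⟨ c ⟩) ^ k) ((⟨ a ⟩ * ⟨ c ⟩) ^ l) ((⟨ a ⟩ * ⟨ b ⟩) ^ m)
                    (⟨ Sₘ ⟩) (c ⁻¹) Bₖ Bₗ ⟩
        U k * (V l * W m) ∎
        where
        m = n ∸ k ∸ l
        M = multinom n k l
        Sₘ = S m (c ∸ 1)
        N = M ℕ.* Sₘ ℕ.* a ℕ.^ (l ℕ.+ m) ℕ.* b ℕ.^ (k ℕ.+ m) ℕ.* c ℕ.^ (k ℕ.+ l)
        Bₖ = B k (⟨ a ⟩ * y₁)
        Bₗ = B l (⟨ b ⟩ * y₂)
        ⟨N⟩≈ : ⟨ N ⟩ ≈ ⟨ M ⟩ * ⟨ Sₘ ⟩ * ⟨ a ⟩ ^ (l ℕ.+ m) * ⟨ b ⟩ ^ (k ℕ.+ m) * ⟨ c ⟩ ^ (k ℕ.+ l)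
        ⟨N⟩≈ = trans (⟨*⟩ (M ℕ.* Sₘ ℕ.* aˡ⁺ᵐ ℕ.* bᵏ⁺ᵐ) cᵏ⁺ˡ) (*-cong
                 (trans (⟨*⟩ (M ℕ.* Sₘ ℕ.* aˡ⁺ᵐ) bᵏ⁺ᵐ) (*-cong
                   (trans (⟨*⟩ (M ℕ.* Sₘ) aˡ⁺ᵐ) (*-cong (⟨*⟩ M Sₘ) (⟨^⟩ a (l ℕ.+ m))))
                   (⟨^⟩ b (k ℕ.+ m))))
                 (⟨^⟩ c (k ℕ.+ l)))
          where
          aˡ⁺ᵐ = a ℕ.^ (l ℕ.+ m)
          bᵏ⁺ᵐ = b ℕ.^ (k ℕ.+ m)
          cᵏ⁺ˡ = c ℕ.^ (k ℕ.+ l)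

      E-egf : egf (E a b c y₁ y₂) ≋ U ⊛ (V ⊛ W)
      E-egf n = begin
        E a b c y₁ y₂ n * n !⁻¹
          ≈⟨ *-distribʳ-Σ< (suc n) (n !⁻¹) _ ⟩
        Σ< (suc n) (λ k → Σ< (suc (n ∸ k)) (summand n k) * n !⁻¹)
          ≈⟨ Σ<-cong (suc n) (λ k _ → *-distribʳ-Σ< (suc (n ∸ k)) (n !⁻¹) _) ⟩
        Σ< (suc n) (λ k → Σ< (suc (n ∸ k)) (λ l → summand n k l * n !⁻¹))
          ≈⟨ Σ<-cong (suc n) (λ k k≤n → Σ<-cong (suc (n ∸ k)) (λ l l≤n∸k →
               summand*n!⁻¹ (ℕ.s≤s⁻¹ k≤n) (ℕ.s≤s⁻¹ l≤n∸k))) ⟩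
        Σ< (suc n) (λ k → Σ< (suc (n ∸ k)) (λ l → U k * (V l * W (n ∸ k ∸ l))))
          ≈⟨ Σ<-cong (suc n) (λ k _ → *-distribˡ-Σ< (suc (n ∸ k)) (U k) _) ⟨
        (U ⊛ (V ⊛ W)) n ∎

      E-egf⊛kernel : let P = ⟨ a ⟩ * ⟨ b ⟩ * ⟨ c ⟩ in
                     egf (E a b c y₁ y₂) ⊛ kernel (⟨ b ⟩ * ⟨ c ⟩) (⟨ a ⟩ * ⟨ c ⟩) (⟨ a ⟩ * ⟨ b ⟩)
                     ≋ dilate (P * y₁) eᵗ ⊛ (dilate (P * y₂) eᵗ ⊛ [eˢᵗ-1]/st P)
      E-egf⊛kernel n = begin
        (egf (E a b c y₁ y₂) ⊛ (D bc ⊛ (D ac ⊛ D ab))) n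
          ≈⟨ ⊛-congʳ (D bc ⊛ (D ac ⊛ D ab)) E-egf n ⟩
        ((U ⊛ (V ⊛ W)) ⊛ (D bc ⊛ (D ac ⊛ D ab))) n
          ≈⟨ ⊛-interchange U (V ⊛ W) (D bc) (D ac ⊛ D ab) n ⟩
        ((U ⊛ D bc) ⊛ ((V ⊛ W) ⊛ (D ac ⊛ D ab))) n
          ≈⟨ ⊛-congˡ (U ⊛ D bc) (⊛-interchange V W (D ac) (D ab)) n ⟩
        ((U ⊛ D bc) ⊛ ((V ⊛ D ac) ⊛ (W ⊛ D ab))) n
          ≈⟨ ⊛-cong U⊛D≋ (⊛-cong V⊛D≋ (dilate-powerSumEGF⊛[eˢᵗ-1]/st ab c)) n ⟩
        (dilate (P * y₁) eᵗ ⊛ (dilate (P * y₂) eᵗ ⊛ D P)) n ∎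
        where
        D = [eˢᵗ-1]/st
        ab = ⟨ a ⟩ * ⟨ b ⟩
        ac = ⟨ a ⟩ * ⟨ c ⟩
        bc = ⟨ b ⟩ * ⟨ c ⟩
        P = ab * ⟨ c ⟩
        U⊛D≋ : U ⊛ D bc ≋ dilate (P * y₁) eᵗ
        U⊛D≋ = ≋-trans (dilate-bernoulliEGF⊛[eˢᵗ-1]/st bc (⟨ a ⟩ * y₁)) (dilate-congʳ eᵗ
          (solve 4 (λ α β γ η → β :* γ :* (α :* η) := α :* β :* γ :* η) refl (⟨ a ⟩) (⟨ b ⟩) (⟨ c ⟩) y₁))
        V⊛D≋ : V ⊛ D ac ≋ dilate (P * y₂) eᵗ
        V⊛D≋ = ≋-trans (dilate-bernoulliEGF⊛[eˢᵗ-1]/st ac (⟨ b ⟩ * y₂)) (dilate-congʳ eᵗ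
          (solve 4 (λ α β γ η → α :* γ :* (β :* η) := α :* β :* γ :* η) refl (⟨ a ⟩) (⟨ b ⟩) (⟨ c ⟩) y₂))

    E-determined-by-kernel : ∀ a b c a′ b′ c′ .{{_ : NonZero c}} .{{_ : NonZero c′}} y₁ y₂ →
      kernel (⟨ b ⟩ * ⟨ c ⟩) (⟨ a ⟩ * ⟨ c ⟩) (⟨ a ⟩ * ⟨ b ⟩)
        ≋ kernel (⟨ b′ ⟩ * ⟨ c′ ⟩) (⟨ a′ ⟩ * ⟨ c′ ⟩) (⟨ a′ ⟩ * ⟨ b′ ⟩) →
      ⟨ a ⟩ * ⟨ b ⟩ * ⟨ c ⟩ ≈ ⟨ a′ ⟩ * ⟨ b′ ⟩ * ⟨ c′ ⟩ →
      ∀ n → E a b c y₁ y₂ n ≈ E a′ b′ c′ y₁ y₂ n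
    E-determined-by-kernel a b c a′ b′ c′ y₁ y₂ K≋K′ P≈P′ =
      egf-injective (⊛-cancelʳ {egf (E a b c y₁ y₂)} {egf (E a′ b′ c′ y₁ y₂)} {K}
                               (kernel-head (⟨ b ⟩ * ⟨ c ⟩) (⟨ a ⟩ * ⟨ c ⟩) (⟨ a ⟩ * ⟨ b ⟩)) λ n → begin
      (egf (E a b c y₁ y₂) ⊛ K) n
        ≈⟨ E-egf⊛kernel a b c y₁ y₂ n ⟩
      (dilate (P * y₁) eᵗ ⊛ (dilate (P * y₂) eᵗ ⊛ [eˢᵗ-1]/st P)) n
        ≈⟨ ⊛-cong (dilate-congʳ eᵗ (*-congʳ P≈P′)) (⊛-cong (dilate-congʳ eᵗ (*-congʳ P≈P′))
                                                            (dilate-congʳ [eᵗ-1]/t P≈P′)) n ⟩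
      (dilate (P′ * y₁) eᵗ ⊛ (dilate (P′ * y₂) eᵗ ⊛ [eˢᵗ-1]/st P′)) n
        ≈⟨ E-egf⊛kernel a′ b′ c′ y₁ y₂ n ⟨
      (egf (E a′ b′ c′ y₁ y₂) ⊛ K′) n
        ≈⟨ ⊛-congˡ (egf (E a′ b′ c′ y₁ y₂)) K≋K′ n ⟨
      (egf (E a′ b′ c′ y₁ y₂) ⊛ K) n ∎)
      where
      K = kernel (⟨ b ⟩ * ⟨ c ⟩) (⟨ a ⟩ * ⟨ c ⟩) (⟨ a ⟩ * ⟨ b ⟩)
      K′ = kernel (⟨ b′ ⟩ * ⟨ c′ ⟩) (⟨ a′ ⟩ * ⟨ c′ ⟩) (⟨ a′ ⟩ * ⟨ b′ ⟩)
      P = ⟨ a ⟩ * ⟨ b ⟩ * ⟨ c ⟩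
      P′ = ⟨ a′ ⟩ * ⟨ b′ ⟩ * ⟨ c′ ⟩

    E-swap₂₃ : ∀ a b c .{{_ : NonZero b}} .{{_ : NonZero c}} y₁ y₂ n → E a b c y₁ y₂ n ≈ E a c b y₁ y₂ n
    E-swap₂₃ a b c y₁ y₂ = E-determined-by-kernel a b c a c b y₁ y₂
      (≋-trans (kernel-swap₂₃ (⟨ b ⟩ * ⟨ c ⟩) (⟨ a ⟩ * ⟨ c ⟩) (⟨ a ⟩ * ⟨ b ⟩))
               (kernel-cong (*-comm (⟨ b ⟩) (⟨ c ⟩)) refl refl))
      (xy∙z≈xz∙y (⟨ a ⟩) (⟨ b ⟩) (⟨ c ⟩))

    E-swap₁₂ : ∀ a b c .{{_ : NonZero c}} y₁ y₂ n → E a b c y₁ y₂ n ≈ E b a c y₁ y₂ n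
    E-swap₁₂ a b c y₁ y₂ = E-determined-by-kernel a b c b a c y₁ y₂
      (≋-trans (kernel-swap₁₂ (⟨ b ⟩ * ⟨ c ⟩) (⟨ a ⟩ * ⟨ c ⟩) (⟨ a ⟩ * ⟨ b ⟩))
               (kernel-cong refl refl (*-comm (⟨ a ⟩) (⟨ b ⟩))))
      (xy∙z≈yx∙z (⟨ a ⟩) (⟨ b ⟩) (⟨ c ⟩))

-- The identity holds in every ℚ-algebra.
theorem2 : ∀ {c ℓ} (p : ℕ) → Prime p →
  (R : CommutativeRing c ℓ) (ι : ℚ → CommutativeRing.Carrier R) → IsQAlgebraMap R ι →
  (w₁ w₂ w₃ : ℕ) → .{{_ : NonZero w₁}} → .{{_ : NonZero w₂}} → .{{_ : NonZero w₃}} →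
  (y₁ y₂ : CommutativeRing.Carrier R) (n : ℕ) →
  let open CommutativeRing R using (_≈_)
      open QAlg R ι using (E)
  in (E w₁ w₂ w₃ y₁ y₂ n ≈ E w₁ w₃ w₂ y₁ y₂ n)
     × (E w₁ w₃ w₂ y₁ y₂ n ≈ E w₂ w₁ w₃ y₁ y₂ n)
     × (E w₂ w₁ w₃ y₁ y₂ n ≈ E w₂ w₃ w₁ y₁ y₂ n)
     × (E w₂ w₃ w₁ y₁ y₂ n ≈ E w₃ w₂ w₁ y₁ y₂ n)
     × (E w₃ w₂ w₁ y₁ y₂ n ≈ E w₃ w₁ w₂ y₁ y₂ n)
theorem2 _ _ R ι ι-hom w₁ w₂ w₃ y₁ y₂ n =
    swap₂₃ w₁ w₂ w₃
  , trans (sym (swap₂₃ w₁ w₂ w₃)) (swap₁₂ w₁ w₂ w₃)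
  , swap₂₃ w₂ w₁ w₃
  , swap₁₂ w₂ w₃ w₁
  , swap₂₃ w₃ w₂ w₁
  where
  open CommutativeRing R using (_≈_; trans; sym)
  open QAlg R ι using (E)
  swap₂₃ : ∀ a b c .{{_ : NonZero b}} .{{_ : NonZero c}} → E a b c y₁ y₂ n ≈ E a c b y₁ y₂ n
  swap₂₃ a b c = E-swap₂₃ R ι ι-hom a b c y₁ y₂ n
  swap₁₂ : ∀ a b c .{{_ : NonZero c}} → E a b c y₁ y₂ n ≈ E b a c y₁ y₂ n
  swap₁₂ a b c = E-swap₁₂ R ι ι-hom a b c y₁ y₂ n
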